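{- Let $\mathcal{L}$ be a first-order language and $\mathcal{C}$ a set of parameters. For every formula $A \in \mathcal{F}(\mathcal{L},\mathcal{C})$ and all variables $x, y$: 1. $(\forall x)A$ is independent of $x$. 2. If $A$ is independent of $y$, then $(\forall x)A = (\forall y)(A[y/x])$. 3. For every index $i \ge 1$, every sequence of terms $t_1, t_2, \ldots \in \mathcal{T}(\mathcal{L},\mathcal{C})$ and every variable $y$: if $t_j$ is independent of $y$ for every $j \ne i$ such that $x_j$ is free in $A$, then $((\forall x_i)A)[t_1, t_2, \ldots] = (\forall y)(A[t_1, \ldots, t_{i-1}, y, t_{i+1}, \ldots])$.
   Context: A (first-order) language $\mathcal{L}$ is a nonempty set of $n$-ary function symbols and $n$-ary predicate symbols ($n \ge 0$), containing a $0$-ary predicate symbol $\mathbb{F}$. Fix a set of variables $X = \{x_1, x_2, \ldots\}$ and a (possibly empty) set $\mathcal{C}$ of parameters. The terms $\mathcal{T}(\mathcal{L},\mathcal{C})$ form the smallest set of expressions containing the $0$-ary function symbols, the variables and the parameters, and closed under: if $t_1,\ldots,t_n$ are terms and $f$ is an $n$-ary function symbol then $f(t_1,\ldots,t_n)$ is a term. Atomic formulas are the $0$-ary predicate symbols and the expressions $P(t_1,\ldots,t_n)$ with $P$ an $n$-ary predicate symbol and $t_i$ terms. The formulas $\mathcal{F}(\mathcal{L},\mathcal{C})$ form the smallest set containing the atomic formulas and closed under: if $A,B$ are formulas then so are $(A \Rightarrow B)$ and $(\forall A)$; here $\forall$ is a unary formula constructor not attached to any variable. Simultaneous substitution: for a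 term or formula $D$ and a sequence of terms $t_1,t_2,\ldots$, define $D[t_1,t_2,\ldots]$ inductively by: $x_i[t_1,t_2,\ldots] = t_i$; $c[t_1,t_2,\ldots] = c$ for parameters $c$; $f(s_1,\ldots,s_n)[t_1,t_2,\ldots] = f(s_1[t_1,t_2,\ldots],\ldots,s_n[t_1,t_2,\ldots])$ (so $0$-ary symbols are unchanged); $P(s_1,\ldots,s_n)[t_1,t_2,\ldots] = P(s_1[t_1,t_2,\ldots],\ldots,s_n[t_1,t_2,\ldots])$; $(A\Rightarrow B)[t_1,t_2,\ldots] = (A[t_1,t_2,\ldots] \Rightarrow B[t_1,t_2,\ldots])$; $(\forall A)[t_1,t_2,\ldots] = \forall(A[x_1, t_1^+, t_2^+, \ldots])$ where $t^+ := t[x_2,x_3,\ldots]$. (Thus $\forall$ binds the variable $x_1$ of its argument.) Notation: $D[t/x_i] := D[x_1,\ldots,x_{i-1},t,x_{i+1},\ldots]$. $D$ is independent of the variable $x_i$ if $D = D[x_{i+1}/x_i]$; otherwise $x_i$ is free in $D$. For a variable $x_i$, $(\forall x_i)A := \forall(A[x_2,x_3,\ldots,x_i,x_1,x_{i+2},\ldots])$, i.e. the substituted sequence has $x_{j+1}$ in position $j$ for each $j \ne i$ and $x_1$ in position $i$. -}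

module Defs where

open import Data.Nat using (ℕ; zero; suc; _≡ᵇ_)
open import Data.Bool using (if_then_else_)
open import Data.Vec using (Vec; []; _∷_)
open import Relation.Binary.PropositionalEquality using (_≡_)
open import Relation.Nullary using (¬_)

record Language : Set₁ where
  field
    FunSym    : Set
    funArity  : FunSym → ℕ
    PredSym   : Set
    predArity : PredSym → ℕ
    𝔽         : PredSym
    𝔽-arity   : predArity 𝔽 ≡ 0

-- Syntax over a language L and a set C of parameters.
-- Variables x₁, x₂, … are represented 0-based: x_{k+1} = var k.
-- Sequences of terms t₁, t₂, … are functions ℕ → Term (t_{k+1} = t k).
module Syntax (L : Language) (C : Set) where
  open Language L

  data Term : Set where
    var : ℕ → Term
    par : C → Term
    fun : (f : FunSym) → Vec Term (funArity f) → Term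

  data Formula : Set where
    atom : (P : PredSym) → Vec Term (predArity P) → Formula
    _⇒_  : Formula → Formula → Formula
    all  : Formula → Formula

  Seq : Set
  Seq = ℕ → Term

  mutual
    substT : Term → Seq → Term
    substT (var i)    t = t i
    substT (par c)    t = par c
    substT (fun f ss) t = fun f (substTs ss t)

    substTs : ∀ {n} → Vec Term n → Seq → Vec Term n
    substTs []       t = []
    substTs (s ∷ ss) t = substT s t ∷ substTs ss t

  shiftSeq : Seq
  shiftSeq j = var (suc j)

  _⁺ : Term → Term
  s ⁺ = substT s shiftSeq

  liftSeq : Seq → Seq
  liftSeq t zero    = var zero
  liftSeq t (suc j) = (t j) ⁺

  substF : Formula → Seq → Formula
  substF (atom P ss) t = atom P (substTs ss t)
  substF (A ⇒ B)     t = substF A t ⇒ substF B t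
  substF (all A)     t = all (substF A (liftSeq t))

  update : Seq → ℕ → Term → Seq
  update t i s j = if j ≡ᵇ i then s else t j

  idSeq : Seq
  idSeq = var

  _[_/x_]F : Formula → Term → ℕ → Formula
  A [ s /x i ]F = substF A (update idSeq i s)

  _[_/x_]T : Term → Term → ℕ → Term
  D [ s /x i ]T = substT D (update idSeq i s)

  IndepF : Formula → ℕ → Set
  IndepF A i = A ≡ A [ var (suc i) /x i ]F

  IndepT : Term → ℕ → Set
  IndepT D i = D ≡ D [ var (suc i) /x i ]T

  FreeF : ℕ → Formula → Set
  FreeF i A = ¬ IndepF A i

  -- (∀ x_i) A := ∀ (A[x₂, …, x_i, x₁, x_{i+2}, …])
  ∀x : ℕ → Formula → Formula
  ∀x i A = all (substF A (update shiftSeq i (var zero)))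

module Submission where

open import Defs
open import Data.Nat using (ℕ; zero; suc; _≡ᵇ_; _≟_)
open import Data.Nat.Properties using (≡ᵇ⇒≡; ≡⇒≡ᵇ; 1+n≢n)
open import Data.Bool using (true; false)
open import Data.Vec using (Vec; []; _∷_)
open import Data.Vec.Relation.Unary.Any using (Any; here; there)
open import Data.Product using (_×_; _,_; ∃-syntax)
open import Relation.Nullary using (¬_; yes; no; contradiction)
open import Relation.Binary.PropositionalEquality
  using (_≡_; _≢_; _≗_; refl; sym; trans; cong; cong₂; subst; module ≡-Reasoning)

-- Substituting t into (∀x_i)A substitutes into A the composite of the
-- binding renaming [x₂, …, x_i, x₁, x_{i+2}, …] with x₁, t₁⁺, t₂⁺, …, and a
-- substitution only depends on its values at the variables occurring in A.
-- For part 3 the two composite sequences agree on those variables because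
-- y does not occur in the t_j substituted for the other ones. Parts 1 and 2
-- are the instances t = [x_{i+1}/x_i], y = x_i and t = identity, once
-- independence of x_i is shown to mean non-occurrence of x_i: every variable
-- of D[x_{i+1}/x_i] comes from a variable of D, and none is sent to x_i.

module _ {L : Language} {C : Set} where
  open Syntax L C

  update-same : ∀ t i s → update t i s i ≡ s
  update-same t i s with i ≡ᵇ i | ≡⇒≡ᵇ i i refl
  ... | true | _ = refl

  update-other : ∀ t s {i j} → j ≢ i → update t i s j ≡ t j
  update-other t s {i} {j} j≢i with j ≡ᵇ i | ≡ᵇ⇒≡ j i
  ... | false | _    = refl
  ... | true  | j≡i = contradiction (j≡i _) j≢i

  update-idem : ∀ t i s s′ → update (update t i s) i s′ ≗ update t i s′
  update-idem t i s s′ j with j ≟ i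
  ... | yes refl = trans (update-same (update t i s) i s′) (sym (update-same t i s′))
  ... | no j≢i   = trans (update-other (update t i s) s′ j≢i)
                         (trans (update-other t s j≢i) (sym (update-other t s′ j≢i)))

  update-self : ∀ t i → update t i (t i) ≗ t
  update-self t i j with j ≟ i
  ... | yes refl = update-same t i (t i)
  ... | no j≢i   = update-other t (t i) j≢i

  bindSeq : ℕ → Seq
  bindSeq i = update shiftSeq i (var zero)

  data OccursT (i : ℕ) : Term → Set where
    var : OccursT i (var i)
    fun : ∀ {f ss} → Any (OccursT i) ss → OccursT i (fun f ss)

  data OccursF : ℕ → Formula → Set where
    atom : ∀ {i P ss} → Any (OccursT i) ss → OccursF i (atom P ss)
    ⇒ˡ   : ∀ {i A B} → OccursF i A → OccursF i (A ⇒ B)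
    ⇒ʳ   : ∀ {i A B} → OccursF i B → OccursF i (A ⇒ B)
    all  : ∀ {i A} → OccursF (suc i) A → OccursF i (all A)

  occursT-var : ∀ {k m} → OccursT k (var m) → k ≡ m
  occursT-var var = refl

  _⊚_ : Seq → Seq → Seq
  (σ ⊚ τ) j = substT (σ j) τ

  mutual
    substT-cong : ∀ s {σ τ} → (∀ j → OccursT j s → σ j ≡ τ j) →
                  substT s σ ≡ substT s τ
    substT-cong (var i)    eq = eq i var
    substT-cong (par c)    eq = refl
    substT-cong (fun f ss) eq = cong (fun f) (substTs-cong ss (λ j o → eq j (fun o)))

    substTs-cong : ∀ {n} (ss : Vec Term n) {σ τ} → (∀ j → Any (OccursT j) ss → σ j ≡ τ j) →
                   substTs ss σ ≡ substTs ss τ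
    substTs-cong []       eq = refl
    substTs-cong (s ∷ ss) eq =
      cong₂ _∷_ (substT-cong s (λ j o → eq j (here o))) (substTs-cong ss (λ j o → eq j (there o)))

  substF-cong : ∀ A {σ τ} → (∀ j → OccursF j A → σ j ≡ τ j) → substF A σ ≡ substF A τ
  substF-cong (atom P ss) eq = cong (atom P) (substTs-cong ss (λ j o → eq j (atom o)))
  substF-cong (A ⇒ B)     eq =
    cong₂ _⇒_ (substF-cong A (λ j o → eq j (⇒ˡ o))) (substF-cong B (λ j o → eq j (⇒ʳ o)))
  substF-cong (all A) {σ} {τ} eq = cong all (substF-cong A lift-eq)
    where
    lift-eq : ∀ j → OccursF j A → liftSeq σ j ≡ liftSeq τ j
    lift-eq zero    _ = refl
    lift-eq (suc j) o = cong _⁺ (eq j (all o))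

  mutual
    substT-id : ∀ s → substT s idSeq ≡ s
    substT-id (var i)    = refl
    substT-id (par c)    = refl
    substT-id (fun f ss) = cong (fun f) (substTs-id ss)

    substTs-id : ∀ {n} (ss : Vec Term n) → substTs ss idSeq ≡ ss
    substTs-id []       = refl
    substTs-id (s ∷ ss) = cong₂ _∷_ (substT-id s) (substTs-id ss)

  substF-id : ∀ A → substF A idSeq ≡ A
  substF-id (atom P ss) = cong (atom P) (substTs-id ss)
  substF-id (A ⇒ B)     = cong₂ _⇒_ (substF-id A) (substF-id B)
  substF-id (all A)     = cong all (trans (substF-cong A (λ j _ → liftSeq-id j)) (substF-id A))
    where
    liftSeq-id : liftSeq idSeq ≗ idSeq
    liftSeq-id zero    = refl
    liftSeq-id (suc j) = refl

  mutual
    substT-substT : ∀ s σ τ → substT (substT s σ) τ ≡ substT s (σ ⊚ τ)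
    substT-substT (var i)    σ τ = refl
    substT-substT (par c)    σ τ = refl
    substT-substT (fun f ss) σ τ = cong (fun f) (substTs-substTs ss σ τ)

    substTs-substTs : ∀ {n} (ss : Vec Term n) σ τ → substTs (substTs ss σ) τ ≡ substTs ss (σ ⊚ τ)
    substTs-substTs []       σ τ = refl
    substTs-substTs (s ∷ ss) σ τ = cong₂ _∷_ (substT-substT s σ τ) (substTs-substTs ss σ τ)

  substF-substF : ∀ A σ τ → substF (substF A σ) τ ≡ substF A (σ ⊚ τ)
  substF-substF (atom P ss) σ τ = cong (atom P) (substTs-substTs ss σ τ)
  substF-substF (A ⇒ B)     σ τ = cong₂ _⇒_ (substF-substF A σ τ) (substF-substF B σ τ)
  substF-substF (all A)     σ τ =
    cong all (trans (substF-substF A (liftSeq σ) (liftSeq τ)) (substF-cong A (λ j _ → lift-⊚ j)))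
    where
    lift-⊚ : liftSeq σ ⊚ liftSeq τ ≗ liftSeq (σ ⊚ τ)
    lift-⊚ zero    = refl
    lift-⊚ (suc k) = trans (substT-substT (σ k) shiftSeq (liftSeq τ)) (sym (substT-substT (σ k) τ shiftSeq))

  mutual
    occursT-substT : ∀ s {σ k} → OccursT k (substT s σ) → ∃[ j ] OccursT j s × OccursT k (σ j)
    occursT-substT (var i)    o       = i , var , o
    occursT-substT (fun f ss) (fun o) with occursTs-substTs ss o
    ... | j , oj , ok = j , fun oj , ok

    occursTs-substTs : ∀ {n} (ss : Vec Term n) {σ k} → Any (OccursT k) (substTs ss σ) →
                       ∃[ j ] Any (OccursT j) ss × OccursT k (σ j)
    occursTs-substTs (s ∷ ss) (here o) with occursT-substT s o
    ... | j , oj , ok = j , here oj , ok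
    occursTs-substTs (s ∷ ss) (there o) with occursTs-substTs ss o
    ... | j , oj , ok = j , there oj , ok

  occursF-substF : ∀ A {σ k} → OccursF k (substF A σ) → ∃[ j ] OccursF j A × OccursT k (σ j)
  occursF-substF (atom P ss) (atom o) with occursTs-substTs ss o
  ... | j , oj , ok = j , atom oj , ok
  occursF-substF (A ⇒ B) (⇒ˡ o) with occursF-substF A o
  ... | j , oj , ok = j , ⇒ˡ oj , ok
  occursF-substF (A ⇒ B) (⇒ʳ o) with occursF-substF B o
  ... | j , oj , ok = j , ⇒ʳ oj , ok
  occursF-substF (all A) {σ} (all o) with occursF-substF A o
  ... | zero  , _  , ()
  ... | suc j , oj , ok with occursT-substT (σ j) ok
  ...   | m , om , var = j , all oj , om

  renamed-away : ∀ i j → ¬ OccursT i (update idSeq i (var (suc i)) j)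
  renamed-away i j o with j ≟ i
  ... | yes refl = 1+n≢n (sym (occursT-var (subst (OccursT i) (update-same idSeq i (var (suc i))) o)))
  ... | no j≢i   = j≢i (sym (occursT-var (subst (OccursT i) (update-other idSeq (var (suc i)) j≢i) o)))

  indepT⇒¬occursT : ∀ {s i} → IndepT s i → ¬ OccursT i s
  indepT⇒¬occursT {s} {i} indep o with occursT-substT s (subst (OccursT i) indep o)
  ... | j , _ , ok = renamed-away i j ok

  indepF⇒¬occursF : ∀ {A i} → IndepF A i → ¬ OccursF i A
  indepF⇒¬occursF {A} {i} indep o with occursF-substF A (subst (OccursF i) indep o)
  ... | j , _ , ok = renamed-away i j ok

  substF-∀x : ∀ A i t z → (∀ j → j ≢ i → OccursF j A → ¬ OccursT z (t j)) →
              substF (∀x i A) t ≡ ∀x z (substF A (update t i (var z)))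
  substF-∀x A i t z fresh = cong all (begin
      substF (substF A (bindSeq i)) (liftSeq t)           ≡⟨ substF-substF A (bindSeq i) (liftSeq t) ⟩
      substF A (bindSeq i ⊚ liftSeq t)                    ≡⟨ substF-cong A agree ⟩
      substF A (update t i (var z) ⊚ bindSeq z)           ≡⟨ substF-substF A (update t i (var z)) (bindSeq z) ⟨
      substF (substF A (update t i (var z))) (bindSeq z)  ∎)
    where
    open ≡-Reasoning
    agree : ∀ j → OccursF j A → (bindSeq i ⊚ liftSeq t) j ≡ (update t i (var z) ⊚ bindSeq z) j
    agree j o with j ≟ i
    ... | yes refl rewrite update-same shiftSeq j (var zero)
                         | update-same t j (var z)
                         | update-same shiftSeq z (var zero) = refl
    ... | no j≢i rewrite update-other shiftSeq (var zero) j≢i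
                       | update-other t (var z) j≢i =
      substT-cong (t j) λ k ok → sym (update-other shiftSeq (var zero) λ { refl → fresh j j≢i o ok })

mainTheorem1 : (L : Language) (C : Set) →
    let open Syntax L C in
    (A : Formula) (x y : ℕ) →
      IndepF (∀x x A) x
      × (IndepF A y → ∀x x A ≡ ∀x y (A [ var y /x x ]F))
      × ((i : ℕ) (t : Seq) (z : ℕ) →
           ((j : ℕ) → j ≢ i → FreeF j A → IndepT (t j) z) →
           substF (∀x i A) t ≡ ∀x z (substF A (update t i (var z))))
mainTheorem1 L C A x y = ∀x-independent , ∀x-rename , ∀x-subst
  where
  open Syntax L C

  ∀x-subst : ∀ i t z → (∀ j → j ≢ i → FreeF j A → IndepT (t j) z) →
             substF (∀x i A) t ≡ ∀x z (substF A (update t i (var z)))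
  ∀x-subst i t z indep = substF-∀x A i t z λ j j≢i o →
    indepT⇒¬occursT (indep j j≢i λ indepA → indepF⇒¬occursF indepA o)

  ∀x-rename : IndepF A y → ∀x x A ≡ ∀x y (A [ var y /x x ]F)
  ∀x-rename indep = trans (sym (substF-id (∀x x A)))
    (substF-∀x A x idSeq y λ { j _ o var → indepF⇒¬occursF indep o })

  ∀x-independent : IndepF (∀x x A) x
  ∀x-independent =
    sym (trans (substF-∀x A x ρ x λ j _ _ → renamed-away x j) (cong (∀x x) restore))
    where
    ρ : Seq
    ρ = update idSeq x (var (suc x))
    restore : substF A (update ρ x (var x)) ≡ A
    restore = trans (substF-cong A λ j _ → trans (update-idem idSeq x _ _ j) (update-self idSeq x j))
                    (substF-id A)
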